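{- If $r\ge 2$ and $2\le d_1 \leq \min\{d_2, \ldots, d_r\}$, then ${\rm gpack}(P_{d_1} \boxtimes \cdots \boxtimes P_{d_r}) = d_2\cdot d_3 \cdots d_r$.
   Context: $P_d$ denotes the path on $d$ vertices. The strong product $G\boxtimes H$ has vertex set $V(G)\times V(H)$, with $(g,h)$ adjacent to $(g',h')$ iff either $g=g'$ and $hh'\in E(H)$, or $h=h'$ and $gg'\in E(G)$, or $gg'\in E(G)$ and $hh'\in E(H)$. A geodesic is a shortest path; it is maximal if it is not contained as a subpath in any other geodesic. A geodesic packing of $G$ is a set of pairwise vertex-disjoint maximal geodesics of $G$, and ${\rm gpack}(G)$ is the maximum cardinality of a geodesic packing of $G$. -}

module Defs where

open import Level using (Level; suc; _⊔_)
open import Data.Nat using (ℕ; _≤_) renaming (suc to sucℕ)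
open import Data.Fin using (Fin; toℕ)
open import Data.Product using (_×_; Σ; _,_)
open import Data.Sum using (_⊎_)
open import Data.Empty using (⊥)
open import Data.List using (List; []; _∷_; length)
open import Data.List.Relation.Unary.Linked using (Linked)
open import Data.List.Relation.Unary.AllPairs using (AllPairs)
open import Data.List.Relation.Unary.All using (All)
open import Data.List.Relation.Binary.Infix.Heterogeneous using (Infix)
open import Data.List.Membership.Propositional using (_∈_)
open import Relation.Binary.PropositionalEquality using (_≡_)
open import Relation.Nullary using (¬_)

record Graph : Set₁ where
  field
    V : Set
    E : V → V → Set

open Graph public

PathGraph : ℕ → Graph
PathGraph d = record
  { V = Fin d
  ; E = λ i j → (toℕ j ≡ sucℕ (toℕ i)) ⊎ (toℕ i ≡ sucℕ (toℕ j)) }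

_⊠_ : Graph → Graph → Graph
G ⊠ H = record
  { V = V G × V H
  ; E = λ { (g , h) (g' , h') →
        ((g ≡ g') × E H h h')
      ⊎ ((h ≡ h') × E G g g')
      ⊎ (E G g g' × E H h h') } }

infixr 7 _⊠_

strongPathProduct : ℕ → List ℕ → Graph
strongPathProduct d []       = PathGraph d
strongPathProduct d (e ∷ es) = PathGraph d ⊠ strongPathProduct e es

module _ (G : Graph) where

  lastOf : V G → List (V G) → V G
  lastOf u []       = u
  lastOf u (x ∷ xs) = lastOf x xs

  -- A walk: a nonempty sequence of vertices, consecutive ones adjacent.
  -- Its length (number of edges) is length xs for the walk u ∷ xs.
  IsWalk : List (V G) → Set
  IsWalk []       = ⊥
  IsWalk (u ∷ xs) = Linked (E G) (u ∷ xs)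

  IsGeodesic : List (V G) → Set
  IsGeodesic []       = ⊥
  IsGeodesic (u ∷ xs) =
    Linked (E G) (u ∷ xs) ×
    (∀ (ys : List (V G)) → Linked (E G) (u ∷ ys) →
       lastOf u ys ≡ lastOf u xs → length xs ≤ length ys)

  IsMaximalGeodesic : List (V G) → Set
  IsMaximalGeodesic p =
    IsGeodesic p ×
    (∀ q → IsGeodesic q → Infix _≡_ p q → length q ≤ length p)

  VertexDisjoint : List (V G) → List (V G) → Set
  VertexDisjoint p q = ∀ v → v ∈ p → v ∈ q → ⊥

  IsGeodesicPacking : List (List (V G)) → Set
  IsGeodesicPacking ps = All IsMaximalGeodesic ps × AllPairs VertexDisjoint ps

  GPack≡ : ℕ → Set
  GPack≡ k =
    Σ (List (List (V G))) (λ ps → IsGeodesicPacking ps × length ps ≡ k) ×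
    (∀ ps → IsGeodesicPacking ps → length ps ≤ k)

-- Distances in P_{d₁} ⊠ ⋯ ⊠ P_{d_r} are maxima of coordinate distances.  If
-- d(u, v) ≤ d₁ − 2 then some coordinate realising the maximum can still move
-- one step away at one end of a shortest u–v path, so every maximal geodesic
-- has at least d₁ vertices; disjoint ones cover at most all d₁ d₂ ⋯ d_r
-- vertices, so there are at most d₂ ⋯ d_r of them.  Conversely, for each vertex
-- w of P_{d₂} ⊠ ⋯ ⊠ P_{d_r} the line P_{d₁} × {w} is a maximal geodesic: a
-- geodesic extending it by a and b steps changes the second coordinate by at
-- most a + b, which is less than its length, so its length is the (at most
-- d₁ − 1) distance in P_{d₁}.
module Submission where

open import Defs
open import Data.Nat using (ℕ; zero; suc; _+_; _*_; _⊔_; _≤_; _<_; z≤n; s≤s; s≤s⁻¹; z<s; ∣_-_∣; >-nonZero)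
open import Data.Nat.Properties
open import Data.Nat.ListAction using (product)
open import Data.Fin using (Fin; toℕ; fromℕ; fromℕ<; inject₁) renaming (zero to fzero; suc to fsuc)
open import Data.Fin.Properties using (toℕ-injective; toℕ-fromℕ; toℕ-fromℕ<; toℕ-inject₁; toℕ<n)
open import Data.Product using (_×_; Σ; ∃; ∃₂; _,_; proj₁; proj₂)
import Data.Product as Product
open import Data.Sum using (_⊎_; inj₁; inj₂)
import Data.Sum as Sum
open import Data.List using (List; []; _∷_; length; _++_; [_]; map; concat; allFin; cartesianProduct)
open import Data.List.Properties using (length-++; length-++-sucʳ; length-map; length-tabulate)
open import Data.List.Relation.Unary.Linked using (Linked; [-]; _∷_)
import Data.List.Relation.Unary.Linked as Linked
import Data.List.Relation.Unary.Linked.Properties as Linkedₚ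
open import Data.List.Relation.Unary.All using (All; []; _∷_)
import Data.List.Relation.Unary.All as All
open import Data.List.Relation.Unary.All.Properties using (¬Any⇒All¬)
import Data.List.Relation.Unary.AllPairs as AllPairs
import Data.List.Relation.Unary.AllPairs.Properties as AllPairs
open import Data.List.Relation.Unary.Unique.Propositional using (Unique; []; _∷_)
import Data.List.Relation.Unary.Unique.Propositional.Properties as Unique
import Data.List.Relation.Binary.Pointwise as Pointwise
open import Data.List.Relation.Binary.Prefix.Heterogeneous using (Prefix; []; _∷_)
open import Data.List.Relation.Binary.Infix.Heterogeneous using (Infix; here; there; _++ⁱ_; _ⁱ++_)
open import Data.List.Relation.Binary.Infix.Heterogeneous.Properties using (fromPointwise)
open import Data.List.Membership.Propositional using (_∈_; _∉_)
open import Data.List.Membership.Propositional.Properties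
  using (∈-∃++; ∈-++⁻; ∈-++⁺ˡ; ∈-++⁺ʳ; ∈-map⁻; ∈-allFin; ∈-cartesianProduct⁺)
open import Data.List.Relation.Unary.Any using (here; there)
open import Function using (_∘_)
open import Relation.Nullary using (¬_; yes; no; contradiction)
open import Relation.Binary.Definitions using (tri<; tri≈; tri>)
open import Relation.Binary.PropositionalEquality
  using (_≡_; refl; sym; trans; cong; cong₂; subst; subst₂; module ≡-Reasoning)

prefix-∃++ : ∀ {A : Set} {xs ys : List A} → Prefix _≡_ xs ys → ∃ λ zs → ys ≡ xs ++ zs
prefix-∃++ []         = _ , refl
prefix-∃++ (refl ∷ p) = Product.map₂ (cong (_ ∷_)) (prefix-∃++ p)

Unique-⊆⇒length≤ : ∀ {A : Set} {xs ys : List A} →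
                   Unique xs → (∀ {z} → z ∈ xs → z ∈ ys) → length xs ≤ length ys
Unique-⊆⇒length≤ {xs = []}     _            _   = z≤n
Unique-⊆⇒length≤ {xs = x ∷ xs} (x∉xs ∷ uxs) sub with ∈-∃++ (sub (here refl))
... | as , bs , refl = begin
  suc (length xs)         ≤⟨ s≤s (Unique-⊆⇒length≤ uxs sub′) ⟩
  suc (length (as ++ bs)) ≡⟨ length-++-sucʳ as x bs ⟨
  length (as ++ x ∷ bs)   ∎
  where
  open ≤-Reasoning
  sub′ : ∀ {z} → z ∈ xs → z ∈ as ++ bs
  sub′ {z} z∈xs with ∈-++⁻ as (sub (there z∈xs))
  ... | inj₁ z∈as         = ∈-++⁺ˡ z∈as
  ... | inj₂ (here refl)  = contradiction refl (All.lookup x∉xs z∈xs)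
  ... | inj₂ (there z∈bs) = ∈-++⁺ʳ as z∈bs

length-cartesianProduct : ∀ {A B : Set} (xs : List A) (ys : List B) →
                          length (cartesianProduct xs ys) ≡ length xs * length ys
length-cartesianProduct []       ys = refl
length-cartesianProduct (x ∷ xs) ys = trans (length-++ (map (x ,_) ys))
  (cong₂ _+_ (length-map (x ,_) ys) (length-cartesianProduct xs ys))

length-concat≥ : ∀ {A : Set} {m} (ps : List (List A)) →
                 All (λ p → m ≤ length p) ps → length ps * m ≤ length (concat ps)
length-concat≥         []       []         = z≤n
length-concat≥ {m = m} (p ∷ ps) (m≤p ∷ hs) =
  subst (length (p ∷ ps) * m ≤_) (sym (length-++ p)) (+-mono-≤ m≤p (length-concat≥ ps hs))

module _ (G : Graph) where

  lastOf-++ : ∀ u xs ys → lastOf G u (xs ++ ys) ≡ lastOf G (lastOf G u xs) ys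
  lastOf-++ u []       ys = refl
  lastOf-++ u (x ∷ xs) ys = lastOf-++ x xs ys

  Linked-++⁻ : ∀ u xs ys → Linked (E G) (u ∷ xs ++ ys) →
               Linked (E G) (u ∷ xs) × Linked (E G) (lastOf G u xs ∷ ys)
  Linked-++⁻ u []       ys l       = [-] , l
  Linked-++⁻ u (x ∷ xs) ys (e ∷ l) = Product.map₁ (e ∷_) (Linked-++⁻ x xs ys l)

  Linked-∷ʳ : ∀ u xs {w} → Linked (E G) (u ∷ xs) → E G (lastOf G u xs) w →
              Linked (E G) (u ∷ xs ++ [ w ])
  Linked-∷ʳ u []       l        e = e ∷ [-]
  Linked-∷ʳ u (x ∷ xs) (e′ ∷ l) e = e′ ∷ Linked-∷ʳ x xs l e

  Infix-∷⁻ : ∀ {x c xs cs} → Infix _≡_ (x ∷ xs) (c ∷ cs) →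
             ∃₂ λ pre post → cs ≡ pre ++ xs ++ post × lastOf G c pre ≡ x
  Infix-∷⁻ (here (refl ∷ p)) = [] , Product.map₂ (_, refl) (prefix-∃++ p)
  Infix-∷⁻ {cs = c′ ∷ cs} (there p) with Infix-∷⁻ p
  ... | pre , post , refl , c⋯pre≡x = c′ ∷ pre , post , refl , c⋯pre≡x
  Infix-∷⁻ {cs = []} (there (here ()))

  geodesic-tail : ∀ u x xs → IsGeodesic G (u ∷ x ∷ xs) → IsGeodesic G (x ∷ xs)
  geodesic-tail u x xs (e ∷ l , shortest) =
    l , λ ys lys same-end → s≤s⁻¹ (shortest (x ∷ ys) (e ∷ lys) same-end)

  geodesic-head∉ : ∀ u xs → IsGeodesic G (u ∷ xs) → u ∉ xs
  geodesic-head∉ u xs (l , shortest) u∈xs with ∈-∃++ u∈xs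
  ... | as , bs , refl = <⇒≱ shortcut-shorter (shortest bs shortcut (sym (lastOf-++ u as (u ∷ bs))))
    where
    shortcut : Linked (E G) (u ∷ bs)
    shortcut with Linked-++⁻ u as (u ∷ bs) l
    ... | _ , _ ∷ l′ = l′
    shortcut-shorter : length bs < length (as ++ u ∷ bs)
    shortcut-shorter rewrite length-++-sucʳ as u bs | length-++ as {bs} = s≤s (m≤n+m (length bs) (length as))

  geodesic-unique : ∀ p → IsGeodesic G p → Unique p
  geodesic-unique (u ∷ [])     _   = [] ∷ []
  geodesic-unique (u ∷ x ∷ xs) geo =
    ¬Any⇒All¬ (x ∷ xs) (geodesic-head∉ u (x ∷ xs) geo) ∷ geodesic-unique (x ∷ xs) (geodesic-tail u x xs geo)

-- Graph metrics

-- The axioms force dist to be the shortest-walk distance (dist≤walkLength,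
-- walkOfLength).
record GraphMetric (G : Graph) : Set where
  field
    dist          : V G → V G → ℕ
    dist-refl     : ∀ x → dist x x ≡ 0
    dist≡0⇒≡      : ∀ x y → dist x y ≡ 0 → x ≡ y
    dist-triangle : ∀ x y z → dist x z ≤ dist x y + dist y z
    dist-edge     : ∀ {x y} → E G x y → dist x y ≤ 1
    dist-step     : ∀ x y n → dist x y ≡ suc n → Σ (V G) λ x′ → E G x x′ × dist x′ y ≡ n

open GraphMetric public

-- A shortest u–v path can be prolonged by an edge at v or at u, keeping it
-- shortest.
Extension : {G : Graph} → GraphMetric G → V G → V G → Set
Extension {G} M u v =
  (Σ (V G) λ w → E G v w × dist M u w ≡ suc (dist M u v)) ⊎
  (Σ (V G) λ w → E G w u × dist M w v ≡ suc (dist M u v))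

Extensible : {G : Graph} → GraphMetric G → ℕ → Set
Extensible M m = ∀ u v → 2 + dist M u v ≤ m → Extension M u v

module _ {G : Graph} (M : GraphMetric G) where

  dist≤walkLength : ∀ u xs → Linked (E G) (u ∷ xs) → dist M u (lastOf G u xs) ≤ length xs
  dist≤walkLength u []       _       = ≤-reflexive (dist-refl M u)
  dist≤walkLength u (x ∷ xs) (e ∷ l) =
    ≤-trans (dist-triangle M u x (lastOf G x xs)) (+-mono-≤ (dist-edge M e) (dist≤walkLength x xs l))

  walkOfLength : ∀ n u v → dist M u v ≡ n →
                 Σ (List (V G)) λ ys → Linked (E G) (u ∷ ys) × lastOf G u ys ≡ v × length ys ≡ n
  walkOfLength zero    u v d≡0 = [] , [-] , dist≡0⇒≡ M u v d≡0 , refl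
  walkOfLength (suc n) u v d≡n+1 with dist-step M u v n d≡n+1
  ... | u′ , e , d≡n with walkOfLength n u′ v d≡n
  ...   | ys , l , ends , len = u′ ∷ ys , e ∷ l , ends , cong suc len

  geodesic-length : ∀ u xs → IsGeodesic G (u ∷ xs) → length xs ≡ dist M u (lastOf G u xs)
  geodesic-length u xs (l , shortest) with walkOfLength _ u (lastOf G u xs) refl
  ... | ys , lys , ends , len =
    ≤-antisym (≤-trans (shortest ys lys ends) (≤-reflexive len)) (dist≤walkLength u xs l)

  geodesic-fromDist : ∀ u xs → Linked (E G) (u ∷ xs) → length xs ≤ dist M u (lastOf G u xs) →
                      IsGeodesic G (u ∷ xs)
  geodesic-fromDist u xs l len≤dist = l , λ ys lys ends →
    ≤-trans len≤dist (subst (λ t → dist M u t ≤ length ys) ends (dist≤walkLength u ys lys))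

  geodesic-∷ʳ : ∀ u xs {w} → IsGeodesic G (u ∷ xs) → E G (lastOf G u xs) w →
                dist M u w ≡ suc (dist M u (lastOf G u xs)) → IsGeodesic G (u ∷ xs ++ [ w ])
  geodesic-∷ʳ u xs {w} geo e farther = geodesic-fromDist u (xs ++ [ w ]) (Linked-∷ʳ G u xs (proj₁ geo) e) (begin
    length (xs ++ [ w ])                      ≡⟨ length-++ xs ⟩
    length xs + 1                             ≡⟨ +-comm (length xs) 1 ⟩
    suc (length xs)                           ≡⟨ cong suc (geodesic-length u xs geo) ⟩
    suc (dist M u (lastOf G u xs))            ≡⟨ farther ⟨
    dist M u w                                ≡⟨ cong (dist M u) (lastOf-++ G u xs [ w ]) ⟨
    dist M u (lastOf G u (xs ++ [ w ]))       ∎)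
    where open ≤-Reasoning

  geodesic-∷ : ∀ u xs {w} → IsGeodesic G (u ∷ xs) → E G w u →
               dist M w (lastOf G u xs) ≡ suc (dist M u (lastOf G u xs)) → IsGeodesic G (w ∷ u ∷ xs)
  geodesic-∷ u xs geo e farther = geodesic-fromDist _ (u ∷ xs) (e ∷ proj₁ geo)
    (≤-reflexive (trans (cong suc (geodesic-length u xs geo)) (sym farther)))

  maximalGeodesic-length≥ : ∀ {m} → Extensible M m → ∀ p → IsMaximalGeodesic G p → m ≤ length p
  maximalGeodesic-length≥ {m} ext (u ∷ xs) (geo , maximal) with m ≤? length (u ∷ xs)
  ... | yes m≤len = m≤len
  ... | no m≰len with ext u (lastOf G u xs) short
    where
    short : 2 + dist M u (lastOf G u xs) ≤ m
    short = subst (λ t → 2 + t ≤ m) (geodesic-length u xs geo) (≰⇒> m≰len)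
  ...   | inj₁ (w , e , farther) = contradiction
    (maximal _ (geodesic-∷ʳ u xs geo e farther) (fromPointwise (Pointwise.refl refl) ⁱ++ [ w ]))
    (<⇒≱ (≤-reflexive (cong suc (sym (trans (length-++ xs) (+-comm (length xs) 1))))))
  ...   | inj₂ (w , e , farther) = contradiction
    (maximal _ (geodesic-∷ u xs geo e farther) ([ w ] ++ⁱ fromPointwise (Pointwise.refl refl)))
    (<⇒≱ ≤-refl)

module _ (G : Graph) where

  packing-length*m≤ : ∀ {m} vs ps → (∀ v → v ∈ vs) → (∀ p → IsMaximalGeodesic G p → m ≤ length p) →
                      IsGeodesicPacking G ps → length ps * m ≤ length vs
  packing-length*m≤ vs ps complete long (maximal , disjoint) = ≤-trans
    (length-concat≥ ps (All.map (λ {p} → long p) maximal))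
    (Unique-⊆⇒length≤ concat-unique (λ {v} _ → complete v))
    where
    concat-unique : Unique (concat ps)
    concat-unique = Unique.concat⁺
      (All.map (λ {p} → geodesic-unique G p ∘ proj₁) maximal)
      (AllPairs.map (λ {p} {q} p#q {v} v∈pq → p#q v (proj₁ v∈pq) (proj₂ v∈pq)) disjoint)

-- The path metric

∣m-1+n∣≡1+∣m-n∣ : ∀ {m n} → m ≤ n → ∣ m - suc n ∣ ≡ suc ∣ m - n ∣
∣m-1+n∣≡1+∣m-n∣ z≤n       = refl
∣m-1+n∣≡1+∣m-n∣ (s≤s m≤n) = ∣m-1+n∣≡1+∣m-n∣ m≤n

m<n⇒∣m-n∣≡1+∣1+m-n∣ : ∀ {m n} → m < n → ∣ m - n ∣ ≡ suc ∣ suc m - n ∣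
m<n⇒∣m-n∣≡1+∣1+m-n∣ (s≤s m≤n) = ∣m-1+n∣≡1+∣m-n∣ m≤n

∣1+m-n∣≡1+∣m-n∣ : ∀ {m n} → n ≤ m → ∣ suc m - n ∣ ≡ suc ∣ m - n ∣
∣1+m-n∣≡1+∣m-n∣ {m} {n} n≤m = begin
  ∣ suc m - n ∣ ≡⟨ ∣-∣-comm (suc m) n ⟩
  ∣ n - suc m ∣ ≡⟨ ∣m-1+n∣≡1+∣m-n∣ n≤m ⟩
  suc ∣ n - m ∣ ≡⟨ cong suc (∣-∣-comm n m) ⟩
  suc ∣ m - n ∣ ∎
  where open ≡-Reasoning

module _ {d : ℕ} where

  upperNeighbour : (i : Fin d) → suc (toℕ i) < d → Σ (Fin d) λ j → toℕ j ≡ suc (toℕ i)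
  upperNeighbour i lt = fromℕ< lt , toℕ-fromℕ< lt

  lowerNeighbour : (i : Fin d) → 0 < toℕ i → Σ (Fin d) λ j → toℕ i ≡ suc (toℕ j)
  lowerNeighbour (fsuc i) _ = inject₁ i , cong suc (sym (toℕ-inject₁ i))

  pathEdge⇒dist≡1 : ∀ {i j : Fin d} → E (PathGraph d) i j → ∣ toℕ i - toℕ j ∣ ≡ 1
  pathEdge⇒dist≡1 {i} (inj₁ j≡1+i) rewrite j≡1+i =
    trans (∣m-1+n∣≡1+∣m-n∣ (≤-refl {toℕ i})) (cong suc (∣n-n∣≡0 (toℕ i)))
  pathEdge⇒dist≡1 {j = j} (inj₂ i≡1+j) rewrite i≡1+j =
    trans (∣1+m-n∣≡1+∣m-n∣ (≤-refl {toℕ j})) (cong suc (∣n-n∣≡0 (toℕ j)))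

  pathMetric-step : ∀ (i j : Fin d) n → ∣ toℕ i - toℕ j ∣ ≡ suc n →
             Σ (Fin d) λ i′ → E (PathGraph d) i i′ × ∣ toℕ i′ - toℕ j ∣ ≡ n
  pathMetric-step i j n d≡n+1 with <-cmp (toℕ i) (toℕ j)
  ... | tri< i<j _ _ with upperNeighbour i (≤-<-trans i<j (toℕ<n j))
  ...   | i′ , i′≡1+i = i′ , inj₁ i′≡1+i ,
          suc-injective (trans (cong (λ t → suc ∣ t - toℕ j ∣) i′≡1+i)
                               (trans (sym (m<n⇒∣m-n∣≡1+∣1+m-n∣ i<j)) d≡n+1))
  pathMetric-step i j n d≡n+1 | tri≈ _ i≡j _ = contradiction (trans (sym (m≡n⇒∣m-n∣≡0 i≡j)) d≡n+1) 0≢1+n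
  pathMetric-step i j n d≡n+1 | tri> _ _ j<i with lowerNeighbour i (≤-<-trans z≤n j<i)
  ...   | i′ , i≡1+i′ = i′ , inj₂ i≡1+i′ ,
          suc-injective (trans (sym (∣1+m-n∣≡1+∣m-n∣ (s≤s⁻¹ (subst (toℕ j <_) i≡1+i′ j<i))))
                               (trans (cong (λ t → ∣ t - toℕ j ∣) (sym i≡1+i′)) d≡n+1))

pathMetric : (d : ℕ) → GraphMetric (PathGraph d)
pathMetric d = record
  { dist          = λ i j → ∣ toℕ i - toℕ j ∣
  ; dist-refl     = λ i → ∣n-n∣≡0 (toℕ i)
  ; dist≡0⇒≡      = λ i j → toℕ-injective ∘ ∣m-n∣≡0⇒m≡n
  ; dist-triangle = λ i j k → ∣-∣-triangle (toℕ i) (toℕ j) (toℕ k)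
  ; dist-edge     = ≤-reflexive ∘ pathEdge⇒dist≡1
  ; dist-step     = pathMetric-step
  }

pathExtension-swap : ∀ {d} {u v : Fin d} → Extension (pathMetric d) v u → Extension (pathMetric d) u v
pathExtension-swap {u = u} {v} (inj₁ (w , u~w , farther)) = inj₂ (w , Sum.swap u~w ,
  trans (∣-∣-comm (toℕ w) (toℕ v)) (trans farther (cong suc (∣-∣-comm (toℕ v) (toℕ u)))))
pathExtension-swap {u = u} {v} (inj₂ (w , w~v , farther)) = inj₁ (w , Sum.swap w~v ,
  trans (∣-∣-comm (toℕ u) (toℕ w)) (trans farther (cong suc (∣-∣-comm (toℕ v) (toℕ u)))))

pathExtension-≤ : ∀ {d} (u v : Fin d) → toℕ u ≤ toℕ v → 2 + ∣ toℕ u - toℕ v ∣ ≤ d →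
                  Extension (pathMetric d) u v
pathExtension-≤ {d} u v u≤v room with suc (toℕ v) <? d
... | yes 1+v<d with upperNeighbour v 1+v<d
...   | w , w≡1+v = inj₁ (w , inj₁ w≡1+v ,
        trans (cong (λ t → ∣ toℕ u - t ∣) w≡1+v) (∣m-1+n∣≡1+∣m-n∣ u≤v))
pathExtension-≤ {d} u v u≤v room | no 1+v≮d with lowerNeighbour u 0<u
  where
  -- with u = 0, the room hypothesis would say v + 1 < d
  0<u : 0 < toℕ u
  0<u = n≢0⇒n>0 λ u≡0 → 1+v≮d (subst (λ t → 2 + ∣ t - toℕ v ∣ ≤ d) u≡0 room)
...   | w , u≡1+w = inj₂ (w , inj₁ u≡1+w ,
        trans (m<n⇒∣m-n∣≡1+∣1+m-n∣ (subst (_≤ toℕ v) u≡1+w u≤v))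
              (cong (λ t → suc ∣ t - toℕ v ∣) (sym u≡1+w)))

pathGraph-extensible : ∀ {m d} → m ≤ d → Extensible (pathMetric d) m
pathGraph-extensible {d = d} m≤d u v short with ≤-total (toℕ u) (toℕ v)
... | inj₁ u≤v = pathExtension-≤ u v u≤v (≤-trans short m≤d)
... | inj₂ v≤u = pathExtension-swap (pathExtension-≤ v u v≤u
  (subst (λ t → 2 + t ≤ d) (∣-∣-comm (toℕ u) (toℕ v)) (≤-trans short m≤d)))

-- The strong product metric

module _ {G H : Graph} (MG : GraphMetric G) (MH : GraphMetric H) where

  ⊠-dist : V (G ⊠ H) → V (G ⊠ H) → ℕ
  ⊠-dist (g , h) (g′ , h′) = dist MG g g′ ⊔ dist MH h h′

  private
    ⊠-dist≡0⇒≡ : ∀ x y → ⊠-dist x y ≡ 0 → x ≡ y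
    ⊠-dist≡0⇒≡ (g , h) (g′ , h′) d≡0 = cong₂ _,_
      (dist≡0⇒≡ MG g g′ (n≤0⇒n≡0 (≤-trans (m≤m⊔n _ _) (≤-reflexive d≡0))))
      (dist≡0⇒≡ MH h h′ (n≤0⇒n≡0 (≤-trans (m≤n⊔m _ _) (≤-reflexive d≡0))))

    ⊠-triangle : ∀ x y z → ⊠-dist x z ≤ ⊠-dist x y + ⊠-dist y z
    ⊠-triangle (g₁ , h₁) (g₂ , h₂) (g₃ , h₃) = ⊔-lub
      (≤-trans (dist-triangle MG g₁ g₂ g₃)
               (+-mono-≤ (m≤m⊔n (dist MG g₁ g₂) (dist MH h₁ h₂)) (m≤m⊔n (dist MG g₂ g₃) (dist MH h₂ h₃))))
      (≤-trans (dist-triangle MH h₁ h₂ h₃)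
               (+-mono-≤ (m≤n⊔m (dist MG g₁ g₂) (dist MH h₁ h₂)) (m≤n⊔m (dist MG g₂ g₃) (dist MH h₂ h₃))))

    ⊠-edge : ∀ {x y} → E (G ⊠ H) x y → ⊠-dist x y ≤ 1
    ⊠-edge {g , _} (inj₁ (refl , h~h′))         = ⊔-lub (≤-trans (≤-reflexive (dist-refl MG g)) z≤n) (dist-edge MH h~h′)
    ⊠-edge {_ , h} (inj₂ (inj₁ (refl , g~g′)))  = ⊔-lub (dist-edge MG g~g′) (≤-trans (≤-reflexive (dist-refl MH h)) z≤n)
    ⊠-edge         (inj₂ (inj₂ (g~g′ , h~h′))) = ⊔-lub (dist-edge MG g~g′) (dist-edge MH h~h′)

    ⊠-step : ∀ x y n → ⊠-dist x y ≡ suc n → Σ (V (G ⊠ H)) λ x′ → E (G ⊠ H) x x′ × ⊠-dist x′ y ≡ n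
    ⊠-step (g , h) (g′ , h′) n d≡n+1 with dist MG g g′ in dG | dist MH h h′ in dH
    ... | zero  | zero  = contradiction d≡n+1 0≢1+n
    ... | zero  | suc b with dist-step MH h h′ b dH
    ...   | h″ , h~h″ , dH′ = (g , h″) , inj₁ (refl , h~h″) ,
            trans (cong₂ _⊔_ dG dH′) (suc-injective d≡n+1)
    ⊠-step (g , h) (g′ , h′) n d≡n+1 | suc a | zero with dist-step MG g g′ a dG
    ...   | g″ , g~g″ , dG′ = (g″ , h) , inj₂ (inj₁ (refl , g~g″)) ,
            trans (cong₂ _⊔_ dG′ dH) (trans (⊔-identityʳ a) (suc-injective d≡n+1))
    ⊠-step (g , h) (g′ , h′) n d≡n+1 | suc a | suc b with dist-step MG g g′ a dG | dist-step MH h h′ b dH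
    ...   | g″ , g~g″ , dG′ | h″ , h~h″ , dH′ = (g″ , h″) , inj₂ (inj₂ (g~g″ , h~h″)) ,
            trans (cong₂ _⊔_ dG′ dH′) (suc-injective d≡n+1)

  _⊠ᴹ_ : GraphMetric (G ⊠ H)
  _⊠ᴹ_ = record
    { dist          = ⊠-dist
    ; dist-refl     = λ (g , h) → cong₂ _⊔_ (dist-refl MG g) (dist-refl MH h)
    ; dist≡0⇒≡      = ⊠-dist≡0⇒≡
    ; dist-triangle = ⊠-triangle
    ; dist-edge     = ⊠-edge
    ; dist-step     = ⊠-step
    }

  ⊠-extensible : ∀ {m} → Extensible MG m → Extensible MH m → Extensible _⊠ᴹ_ m
  ⊠-extensible extG extH (g , h) (g′ , h′) short with ≤-total (dist MH h h′) (dist MG g g′)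
  ... | inj₁ dH≤dG rewrite m≥n⇒m⊔n≡m dH≤dG with extG g g′ short
  ...   | inj₁ (w , g′~w , farther) = inj₁ ((w , h′) , inj₂ (inj₁ (refl , g′~w)) ,
          trans (cong (_⊔ dist MH h h′) farther) (m≥n⇒m⊔n≡m (m≤n⇒m≤1+n dH≤dG)))
  ...   | inj₂ (w , w~g , farther) = inj₂ ((w , h) , inj₂ (inj₁ (refl , w~g)) ,
          trans (cong (_⊔ dist MH h h′) farther) (m≥n⇒m⊔n≡m (m≤n⇒m≤1+n dH≤dG)))
  ⊠-extensible extG extH (g , h) (g′ , h′) short | inj₂ dG≤dH rewrite m≤n⇒m⊔n≡n dG≤dH with extH h h′ short
  ...   | inj₁ (w , h′~w , farther) = inj₁ ((g′ , w) , inj₁ (refl , h′~w) ,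
          trans (cong (dist MG g g′ ⊔_) farther) (m≤n⇒m⊔n≡n (m≤n⇒m≤1+n dG≤dH)))
  ...   | inj₂ (w , w~h , farther) = inj₂ ((g , w) , inj₁ (refl , w~h) ,
          trans (cong (dist MG g g′ ⊔_) farther) (m≤n⇒m⊔n≡n (m≤n⇒m≤1+n dG≤dH)))

m+[n+o]≤n⊔[m+o]⇒m+[n+o]≤n : ∀ m n o → 0 < n → m + (n + o) ≤ n ⊔ (m + o) → m + (n + o) ≤ n
m+[n+o]≤n⊔[m+o]⇒m+[n+o]≤n m n o 0<n le with ⊔-sel n (m + o)
... | inj₁ n⊔[m+o]≡n     = subst (m + (n + o) ≤_) n⊔[m+o]≡n le
... | inj₂ n⊔[m+o]≡m+o = contradiction (subst (m + (n + o) ≤_) n⊔[m+o]≡m+o le) (<⇒≱ (+-monoʳ-< m (m<n+m o 0<n)))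

-- Fibres

module _ {G H : Graph} (MG : GraphMetric G) (MH : GraphMetric H) where

  private
    M = MG ⊠ᴹ MH

  fibre : V H → List (V G) → List (V (G ⊠ H))
  fibre w = map (_, w)

  lastOf-fibre : ∀ w u xs → lastOf (G ⊠ H) (u , w) (fibre w xs) ≡ (lastOf G u xs , w)
  lastOf-fibre w u []       = refl
  lastOf-fibre w u (x ∷ xs) = lastOf-fibre w x xs

  fibre-geodesic : ∀ w u xs → IsGeodesic G (u ∷ xs) → IsGeodesic (G ⊠ H) (fibre w (u ∷ xs))
  fibre-geodesic w u xs geo = geodesic-fromDist M (u , w) (fibre w xs)
    (Linkedₚ.map⁺ (Linked.map (λ g~g′ → inj₂ (inj₁ (refl , g~g′))) (proj₁ geo)))
    (begin
      length (fibre w xs)                              ≡⟨ length-map (_, w) xs ⟩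
      length xs                                        ≡⟨ geodesic-length MG u xs geo ⟩
      dist MG u (lastOf G u xs)                        ≤⟨ m≤m⊔n _ (dist MH w w) ⟩
      dist M (u , w) (lastOf G u xs , w)               ≡⟨ cong (dist M (u , w)) (lastOf-fibre w u xs) ⟨
      dist M (u , w) (lastOf (G ⊠ H) (u , w) (fibre w xs)) ∎)
    where open ≤-Reasoning

  fibre-maximalGeodesic : ∀ w u xs → IsGeodesic G (u ∷ xs) → 0 < length xs →
                          (∀ x y → dist MG x y ≤ length xs) → IsMaximalGeodesic (G ⊠ H) (fibre w (u ∷ xs))
  fibre-maximalGeodesic w u xs geo 0<ℓ diameter = fibre-geodesic w u xs geo , unextendable
    where
    unextendable : ∀ q → IsGeodesic (G ⊠ H) q → Infix _≡_ (fibre w (u ∷ xs)) q →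
                   length q ≤ length (fibre w (u ∷ xs))
    unextendable (c ∷ _) q-geo line⊆q with Infix-∷⁻ (G ⊠ H) line⊆q
    ... | pre , post , refl , c⋯pre≡uw = s≤s (begin
      length cs                                ≡⟨ length-cs ⟩
      length pre + (length line + length post) ≤⟨ m+[n+o]≤n⊔[m+o]⇒m+[n+o]≤n
                                                    (length pre) (length line) (length post) 0<length-line bound ⟩
      length line                              ∎)
      where
      open ≤-Reasoning
      line = fibre w xs
      cs = pre ++ line ++ post
      v = lastOf G u xs
      z = lastOf (G ⊠ H) c cs
      walks = Linked-++⁻ (G ⊠ H) c pre (line ++ post) (proj₁ q-geo)
      to-fibre : dist M c (u , w) ≤ length pre
      to-fibre = subst (λ a → dist M c a ≤ length pre) c⋯pre≡uw (dist≤walkLength M c pre (proj₁ walks))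
      from-fibre : dist M (v , w) z ≤ length post
      from-fibre = subst₂ (λ a b → dist M a b ≤ length post)
        (trans (cong (λ a → lastOf (G ⊠ H) a line) c⋯pre≡uw) (lastOf-fibre w u xs))
        (sym (trans (lastOf-++ (G ⊠ H) c pre (line ++ post)) (lastOf-++ (G ⊠ H) (lastOf (G ⊠ H) c pre) line post)))
        (dist≤walkLength M _ post (proj₂ (Linked-++⁻ (G ⊠ H) (lastOf (G ⊠ H) c pre) line post (proj₂ walks))))
      H-moves : dist MH (proj₂ c) (proj₂ z) ≤ length pre + length post
      H-moves = ≤-trans (dist-triangle MH (proj₂ c) w (proj₂ z))
        (+-mono-≤ (≤-trans (m≤n⊔m (dist MG (proj₁ c) u) _) to-fibre) (≤-trans (m≤n⊔m (dist MG v (proj₁ z)) _) from-fibre))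
      length-cs : length cs ≡ length pre + (length line + length post)
      length-cs = trans (length-++ pre) (cong (length pre +_) (length-++ line))
      0<length-line : 0 < length line
      0<length-line = subst (0 <_) (sym (length-map (_, w) xs)) 0<ℓ
      bound : length pre + (length line + length post) ≤ length line ⊔ (length pre + length post)
      bound = begin
        length pre + (length line + length post) ≡⟨ length-cs ⟨
        length cs                                ≡⟨ geodesic-length M c cs q-geo ⟩
        dist M c z                               ≤⟨ ⊔-mono-≤ (diameter (proj₁ c) (proj₁ z)) H-moves ⟩
        length xs ⊔ (length pre + length post)   ≡⟨ cong (_⊔ (length pre + length post)) (length-map (_, w) xs) ⟨
        length line ⊔ (length pre + length post) ∎

  fibres-packing : ∀ u xs → IsGeodesic G (u ∷ xs) → 0 < length xs → (∀ x y → dist MG x y ≤ length xs) →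
                   (ws : List (V H)) → Unique ws → IsGeodesicPacking (G ⊠ H) (map (λ w → fibre w (u ∷ xs)) ws)
  fibres-packing u xs geo 0<ℓ diameter ws ws-unique =
    All.tabulate {xs = map _ ws} maximal ,
    AllPairs.map⁺ (AllPairs.map fibres-disjoint ws-unique)
    where
    maximal : ∀ {p} → p ∈ map (λ w → fibre w (u ∷ xs)) ws → IsMaximalGeodesic (G ⊠ H) p
    maximal p∈ with ∈-map⁻ _ p∈
    ... | w , _ , refl = fibre-maximalGeodesic w u xs geo 0<ℓ diameter
    fibres-disjoint : ∀ {w w′} → ¬ w ≡ w′ → VertexDisjoint (G ⊠ H) (fibre w (u ∷ xs)) (fibre w′ (u ∷ xs))
    fibres-disjoint w≢w′ _ x∈ x∈′ with ∈-map⁻ _ x∈ | ∈-map⁻ _ x∈′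
    ... | _ , _ , refl | _ , _ , refl = w≢w′ refl

strongPathProductMetric : ∀ d es → GraphMetric (strongPathProduct d es)
strongPathProductMetric d []       = pathMetric d
strongPathProductMetric d (e ∷ es) = pathMetric d ⊠ᴹ strongPathProductMetric e es

strongPathProduct-extensible : ∀ {m} d es → m ≤ d → All (m ≤_) es → Extensible (strongPathProductMetric d es) m
strongPathProduct-extensible d []       m≤d []           = pathGraph-extensible m≤d
strongPathProduct-extensible d (e ∷ es) m≤d (m≤e ∷ m≤es) =
  ⊠-extensible (pathMetric d) (strongPathProductMetric e es)
    (pathGraph-extensible m≤d) (strongPathProduct-extensible e es m≤e m≤es)

vertices : ∀ d es → List (V (strongPathProduct d es))
vertices d []       = allFin d
vertices d (e ∷ es) = cartesianProduct (allFin d) (vertices e es)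

∈-vertices : ∀ d es v → v ∈ vertices d es
∈-vertices d []       i       = ∈-allFin i
∈-vertices d (e ∷ es) (i , v) = ∈-cartesianProduct⁺ (∈-allFin i) (∈-vertices e es v)

vertices-unique : ∀ d es → Unique (vertices d es)
vertices-unique d []       = Unique.allFin⁺ d
vertices-unique d (e ∷ es) = Unique.cartesianProduct⁺ (Unique.allFin⁺ d) (vertices-unique e es)

length-vertices : ∀ d es → length (vertices d es) ≡ product (d ∷ es)
length-vertices d []       = trans (length-tabulate {n = d} (λ i → i)) (sym (*-identityʳ d))
length-vertices d (e ∷ es) = trans (length-cartesianProduct (allFin d) (vertices e es))
  (cong₂ _*_ (length-tabulate {n = d} (λ i → i)) (length-vertices e es))

strongPathProduct-packing≤ : ∀ d es → 0 < d → All (d ≤_) es →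
                             ∀ ps → IsGeodesicPacking (strongPathProduct d es) ps → length ps ≤ product es
strongPathProduct-packing≤ d es 0<d d≤es ps packing = *-cancelʳ-≤ (length ps) (product es) d {{>-nonZero 0<d}} (begin
  length ps * d             ≤⟨ packing-length*m≤ (strongPathProduct d es) (vertices d es) ps (∈-vertices d es)
                                 (maximalGeodesic-length≥ (strongPathProductMetric d es)
                                   (strongPathProduct-extensible d es ≤-refl d≤es)) packing ⟩
  length (vertices d es)    ≡⟨ length-vertices d es ⟩
  d * product es            ≡⟨ *-comm d (product es) ⟩
  product es * d            ∎)
  where open ≤-Reasoning

pathGraph-diameter : ∀ {k} (i j : Fin (suc k)) → dist (pathMetric (suc k)) i j ≤ k
pathGraph-diameter i j = s≤s⁻¹ (≤-<-trans (∣m-n∣≤m⊔n (toℕ i) (toℕ j)) (⊔-lub (toℕ<n i) (toℕ<n j)))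

pathGraph-diametralGeodesic : ∀ k → Σ (List (Fin (suc k))) λ xs →
                              IsGeodesic (PathGraph (suc k)) (fzero ∷ xs) × length xs ≡ k
pathGraph-diametralGeodesic k with walkOfLength (pathMetric (suc k)) k fzero (fromℕ k) (toℕ-fromℕ k)
... | xs , l , ends , len = xs ,
  geodesic-fromDist (pathMetric (suc k)) fzero xs l (≤-reflexive (trans len (sym (trans (cong toℕ ends) (toℕ-fromℕ k))))) ,
  len

strongPathProduct-fibrePacking : ∀ k e es → Σ (List (List (V (strongPathProduct (2 + k) (e ∷ es))))) λ ps →
                                 IsGeodesicPacking (strongPathProduct (2 + k) (e ∷ es)) ps × length ps ≡ product (e ∷ es)
strongPathProduct-fibrePacking k e es with pathGraph-diametralGeodesic (suc k)
... | xs , geo , len =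
  map (λ w → fibre P H w (fzero ∷ xs)) ws ,
  fibres-packing P H fzero xs geo (subst (0 <_) (sym len) z<s)
    (λ i j → subst (dist P i j ≤_) (sym len) (pathGraph-diameter i j)) ws (vertices-unique e es) ,
  trans (length-map _ ws) (length-vertices e es)
  where
  P = pathMetric (2 + k)
  H = strongPathProductMetric e es
  ws = vertices e es

theorem4p3 : (d₁ d₂ : ℕ) (ds : List ℕ) → 2 ≤ d₁ → All (d₁ ≤_) (d₂ ∷ ds) →
    GPack≡ (strongPathProduct d₁ (d₂ ∷ ds)) (product (d₂ ∷ ds))
theorem4p3 d₁@(suc (suc k)) d₂ ds (s≤s (s≤s z≤n)) d₁≤ds =
  strongPathProduct-fibrePacking k d₂ ds , strongPathProduct-packing≤ d₁ (d₂ ∷ ds) z<s d₁≤ds
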